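{- For all terms $M, M', N, N'$: if $M\Rrightarrow M'$, $N\Rightarrow N'$ and $M'$ is not a value, then $MN\Rrightarrow M'N'$.
   Context: Terms and values of the call-by-value $\lambda$-calculus are defined by mutual induction from a countably infinite set of variables: values $V ::= x \mid \lambda x.M$ and terms $M,N,L ::= V \mid MN$, up to $\alpha$-conversion, application associating to the left; $\mathrm{fv}(M)$ is the set of free variables and $M\{V/x\}$ capture-avoiding substitution of a value. $^*$ denotes reflexive-transitive closure. In all rules below $m\ge0$ and $V,V'$ range over values. Head $\beta_v$-reduction $\to_{h\beta_v}$: least relation with $(\lambda x.M)V M_1\dots M_m \to_{h\beta_v} M\{V/x\}M_1\dots M_m$, and if $N\to_{h\beta_v}N'$ then $VNM_1\dots M_m\to_{h\beta_v}VN'M_1\dots M_m$. Head $\sigma$-reduction $\to_{h\sigma}$: least relation with $(\lambda x.M)NLM_1\dots M_m\to_{h\sigma}(\lambda x.ML)NM_1\dots M_m$ ($x\notin\mathrm{fv}(L)$), $V((\lambda x.L)N)M_1\dots M_m\to_{h\sigma}(\lambda x.VL)NM_1\dots M_m$ ($x\notin\mathrm{fv}(V)$), and if $N\to_{h\sigma}N'$ then $VNM_1\dots M_m\to_{h\sigma}VN'M_1\dots M_m$. Parallel reduction $\Rightarrow$ is the least relation closed under: ($\beta_v$) if $V\Rightarrow V'$ and $M_i\Rightarrow M_i'$ for $0\le i\le m$ then $(\lambda x.M_0)VM_1\dots M_m\Rightarrow M_0'\{V'/x\}M_1'\dots M_m'$; ($\sigma_1$) if $N\Rightarrow N'$, $L\Rightarrow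 L'$, $M_i\Rightarrow M_i'$ for $0\le i\le m$, and $x\notin\mathrm{fv}(L)$, then $(\lambda x.M_0)NLM_1\dots M_m\Rightarrow(\lambda x.M_0'L')N'M_1'\dots M_m'$; ($\sigma_3$) if $V\Rightarrow V'$, $N\Rightarrow N'$, $L\Rightarrow L'$, $M_i\Rightarrow M_i'$ for $1\le i\le m$, and $x\notin\mathrm{fv}(V)$, then $V((\lambda x.L)N)M_1\dots M_m\Rightarrow(\lambda x.V'L')N'M_1'\dots M_m'$; ($\lambda$) if $M_i\Rightarrow M_i'$ for $0\le i\le m$ then $(\lambda x.M_0)M_1\dots M_m\Rightarrow(\lambda x.M_0')M_1'\dots M_m'$; (var) if $M_i\Rightarrow M_i'$ for $1\le i\le m$ then $xM_1\dots M_m\Rightarrow xM_1'\dots M_m'$. Internal parallel reduction $\Rightarrow_{int}$ is the least relation with: if $N\Rightarrow N'$ then $\lambda x.N\Rightarrow_{int}\lambda x.N'$; $x\Rightarrow_{int}x$; if $V\Rightarrow V'$, $N\Rightarrow_{int}N'$ and $M_i\Rightarrow M_i'$ for $1\le i\le m$, then $VNM_1\dots M_m\Rightarrow_{int}V'N'M_1'\dots M_m'$. Strong parallel reduction: $M\Rrightarrow N$ iff $M\Rightarrow N$ and there exist terms $M',M''$ with $M\to_{h\beta_v}^*M'\to_{h\sigma}^*M''\Rightarrow_{int}N$. -}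

module Defs where

open import Data.Nat using (ℕ; zero; suc; _<ᵇ_)
open import Data.Bool using (if_then_else_)
open import Data.List using (List; []; _∷_)
open import Data.Product using (_×_; ∃-syntax)
open import Relation.Binary.Construct.Closure.ReflexiveTransitive using (Star)

-- Terms of the untyped λ-calculus, up to α-conversion, via de Bruijn indices.
data Term : Set where
  var : ℕ → Term
  lam : Term → Term
  app : Term → Term → Term

data Value : Term → Set where
  var : (n : ℕ) → Value (var n)
  lam : (M : Term) → Value (lam M)

apps : Term → List Term → Term
apps M []       = M
apps M (N ∷ Ns) = apps (app M N) Ns

shiftFrom : ℕ → Term → Term
shiftFrom c (var n)   = if n <ᵇ c then var n else var (suc n)
shiftFrom c (lam M)   = lam (shiftFrom (suc c) M)
shiftFrom c (app M N) = app (shiftFrom c M) (shiftFrom c N)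

-- Weakening: a term placed under a new binder whose variable does not occur in it
-- (this encodes the side conditions x ∉ fv(L), x ∉ fv(V)).
shift : Term → Term
shift = shiftFrom 0

substAt : ℕ → Term → Term → Term
substAt k U (var n) with n <ᵇ k | k <ᵇ n
... | Data.Bool.true  | _               = var n
... | Data.Bool.false | Data.Bool.false = U
... | Data.Bool.false | Data.Bool.true  = var (Data.Nat.pred n)
substAt k U (lam M)   = lam (substAt (suc k) (shift U) M)
substAt k U (app M N) = app (substAt k U M) (substAt k U N)

-- M{U/x} where x is the variable bound by the enclosing λ.
_[_] : Term → Term → Term
M [ U ] = substAt 0 U M

data _→hβv_ : Term → Term → Set where
  β   : ∀ {M V} → Value V → (Ms : List Term) →
        apps (app (lam M) V) Ms →hβv apps (M [ V ]) Ms
  arg : ∀ {V N N'} → Value V → N →hβv N' → (Ms : List Term) →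
        apps (app V N) Ms →hβv apps (app V N') Ms

data _→hσ_ : Term → Term → Set where
  σ₁  : ∀ {M N L} → (Ms : List Term) →
        apps (app (app (lam M) N) L) Ms →hσ apps (app (lam (app M (shift L))) N) Ms
  σ₃  : ∀ {V L N} → Value V → (Ms : List Term) →
        apps (app V (app (lam L) N)) Ms →hσ apps (app (lam (app (shift V) L)) N) Ms
  arg : ∀ {V N N'} → Value V → N →hσ N' → (Ms : List Term) →
        apps (app V N) Ms →hσ apps (app V N') Ms

infix 4 _⇒_ _⇒ˡ_ _⇒int_ _⇛_
mutual
  data _⇒_ : Term → Term → Set where
    βv  : ∀ {M₀ M₀' V V' Ms Ms'} → Value V → V ⇒ V' → M₀ ⇒ M₀' → Ms ⇒ˡ Ms' →
          apps (app (lam M₀) V) Ms ⇒ apps (M₀' [ V' ]) Ms'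
    σ₁  : ∀ {M₀ M₀' N N' L L' Ms Ms'} → N ⇒ N' → L ⇒ L' → M₀ ⇒ M₀' → Ms ⇒ˡ Ms' →
          apps (app (app (lam M₀) N) L) Ms ⇒ apps (app (lam (app M₀' (shift L'))) N') Ms'
    σ₃  : ∀ {V V' N N' L L' Ms Ms'} → Value V → V ⇒ V' → N ⇒ N' → L ⇒ L' → Ms ⇒ˡ Ms' →
          apps (app V (app (lam L) N)) Ms ⇒ apps (app (lam (app (shift V') L')) N') Ms'
    lam : ∀ {M₀ M₀' Ms Ms'} → M₀ ⇒ M₀' → Ms ⇒ˡ Ms' →
          apps (lam M₀) Ms ⇒ apps (lam M₀') Ms'
    var : ∀ {x Ms Ms'} → Ms ⇒ˡ Ms' →
          apps (var x) Ms ⇒ apps (var x) Ms'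

  data _⇒ˡ_ : List Term → List Term → Set where
    []  : [] ⇒ˡ []
    _∷_ : ∀ {M M' Ms Ms'} → M ⇒ M' → Ms ⇒ˡ Ms' → (M ∷ Ms) ⇒ˡ (M' ∷ Ms')

data _⇒int_ : Term → Term → Set where
  lam : ∀ {N N'} → N ⇒ N' → lam N ⇒int lam N'
  var : (x : ℕ) → var x ⇒int var x
  app : ∀ {V V' N N' Ms Ms'} → Value V → V ⇒ V' → N ⇒int N' → Ms ⇒ˡ Ms' →
        apps (app V N) Ms ⇒int apps (app V' N') Ms'

_⇛_ : Term → Term → Set
M ⇛ N = (M ⇒ N) × ∃[ M' ] ∃[ M'' ]
          (Star _→hβv_ M M' × Star _→hσ_ M' M'' × M'' ⇒int N)

module Submission where

-- Every rule defining head βv-, head σ- and (internal) parallel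
-- reduction has a conclusion of the form  apps H Ms  ⟶  apps H' Ms'  with an
-- arbitrary spine of trailing arguments Ms.  Applying such a term to one more
-- argument N only extends the spine:  app (apps H Ms) N = apps H (Ms ++ N ∷ []).
-- Hence each of these relations is closed under application to a further
-- argument (for ⇒ and ⇒int the argument may itself be reduced in parallel).
--
-- The hypothesis that M' is
-- not a value is needed only for ⇒int: a value is related by ⇒int only through
-- the λ and var rules, which have no argument spine to extend.

open import Defs
open import Relation.Nullary using (¬_)
open import Data.List using (List; []; _∷_; _++_)
open import Data.Product using (_,_)
open import Data.Empty using (⊥-elim)
open import Relation.Binary.PropositionalEquality using (_≡_; refl; sym; subst₂)
open import Relation.Binary.Construct.Closure.ReflexiveTransitive as Star using (Star)

app-apps : ∀ H Ms N → app (apps H Ms) N ≡ apps H (Ms ++ N ∷ [])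
app-apps H []       N = refl
app-apps H (K ∷ Ks) N = app-apps (app H K) Ks N

via-spine : ∀ (R : Term → Term → Set) H H' Ms Ms' {N N'} →
            R (apps H (Ms ++ N ∷ [])) (apps H' (Ms' ++ N' ∷ [])) →
            R (app (apps H Ms) N) (app (apps H' Ms') N')
via-spine R H H' Ms Ms' {N} {N'} =
  subst₂ R (sym (app-apps H Ms N)) (sym (app-apps H' Ms' N'))

_∷ʳˡ_ : ∀ {Ms Ms' N N'} → Ms ⇒ˡ Ms' → N ⇒ N' → (Ms ++ N ∷ []) ⇒ˡ (Ms' ++ N' ∷ [])
[]       ∷ʳˡ r = r ∷ []
(p ∷ ps) ∷ʳˡ r = p ∷ (ps ∷ʳˡ r)

⇒-app : ∀ {M M' N N'} → M ⇒ M' → N ⇒ N' → app M N ⇒ app M' N'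
⇒-app (βv {M₀} {M₀'} {V} {V'} {Ms} {Ms'} v p q ps) r =
  via-spine _⇒_ (app (lam M₀) V) (M₀' [ V' ]) Ms Ms' (βv v p q (ps ∷ʳˡ r))
⇒-app (σ₁ {M₀} {M₀'} {K} {K'} {L} {L'} {Ms} {Ms'} p q s ps) r =
  via-spine _⇒_ (app (app (lam M₀) K) L) (app (lam (app M₀' (shift L'))) K') Ms Ms'
    (σ₁ p q s (ps ∷ʳˡ r))
⇒-app (σ₃ {V} {V'} {K} {K'} {L} {L'} {Ms} {Ms'} v p q s ps) r =
  via-spine _⇒_ (app V (app (lam L) K)) (app (lam (app (shift V') L')) K') Ms Ms'
    (σ₃ v p q s (ps ∷ʳˡ r))
⇒-app (lam {M₀} {M₀'} {Ms} {Ms'} p ps) r =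
  via-spine _⇒_ (lam M₀) (lam M₀') Ms Ms' (lam p (ps ∷ʳˡ r))
⇒-app (var {x} {Ms} {Ms'} ps) r =
  via-spine _⇒_ (var x) (var x) Ms Ms' (var (ps ∷ʳˡ r))

→hβv-appˡ : ∀ {M M'} N → M →hβv M' → app M N →hβv app M' N
→hβv-appˡ N (β {M₀} {V} v Ms) =
  via-spine _→hβv_ (app (lam M₀) V) (M₀ [ V ]) Ms Ms (β v (Ms ++ N ∷ []))
→hβv-appˡ N (arg {V} {K} {K'} v s Ms) =
  via-spine _→hβv_ (app V K) (app V K') Ms Ms (arg v s (Ms ++ N ∷ []))

→hσ-appˡ : ∀ {M M'} N → M →hσ M' → app M N →hσ app M' N
→hσ-appˡ N (σ₁ {M₀} {K} {L} Ms) =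
  via-spine _→hσ_ (app (app (lam M₀) K) L) (app (lam (app M₀ (shift L))) K) Ms Ms
    (σ₁ (Ms ++ N ∷ []))
→hσ-appˡ N (σ₃ {V} {L} {K} v Ms) =
  via-spine _→hσ_ (app V (app (lam L) K)) (app (lam (app (shift V) L)) K) Ms Ms
    (σ₃ v (Ms ++ N ∷ []))
→hσ-appˡ N (arg {V} {K} {K'} v s Ms) =
  via-spine _→hσ_ (app V K) (app V K') Ms Ms (arg v s (Ms ++ N ∷ []))

star-appˡ : ∀ {R : Term → Term → Set} N →
            (∀ {M M'} → R M M' → R (app M N) (app M' N)) →
            ∀ {M M'} → Star R M M' → Star R (app M N) (app M' N)
star-appˡ N step = Star.gmap (λ M → app M N) step

⇒int-app : ∀ {M M' N N'} → M ⇒int M' → N ⇒ N' → ¬ Value M' →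
           app M N ⇒int app M' N'
⇒int-app (lam {N' = B} _) _ not-value = ⊥-elim (not-value (lam B))
⇒int-app (var x)         _ not-value = ⊥-elim (not-value (var x))
⇒int-app (app {V} {V'} {K} {K'} {Ms} {Ms'} v p i ps) r _ =
  via-spine _⇒int_ (app V K) (app V' K') Ms Ms' (app v p i (ps ∷ʳˡ r))

-- The witnesses for  M N  are  M₁ N  and  M₂ N.
lemma3p12 : (M M' N N' : Term) → M ⇛ M' → N ⇒ N' → ¬ Value M' →
    app M N ⇛ app M' N'
lemma3p12 M M' N N' (M⇒M' , M₁ , M₂ , βv-steps , σ-steps , M₂⇒intM') N⇒N' not-value =
    ⇒-app M⇒M' N⇒N'
  , app M₁ N , app M₂ N
  , star-appˡ N (→hβv-appˡ N) βv-steps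
  , star-appˡ N (→hσ-appˡ N) σ-steps
  , ⇒int-app M₂⇒intM' N⇒N' not-value
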